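{- Let $\mathbf L_0$ be a lattice admitting a fixed-point free polynomial $p(x,\mathbf b)$, where $\mathbf b$ is a finite tuple of elements of $\mathbf L_0$ (i.e. $p(a,\mathbf b)\ne a$ for all $a\in L_0$), and let $\mathbf L_1$ be a complete lattice containing $\mathbf L_0$ as a sublattice. Then there is a positive $\forall\exists$-sentence (in the language $\{\vee,\wedge\}$) true in $\mathbf L_1$ and false in $\mathbf L_0$.
   Context: A polynomial of a lattice is a lattice term $p(x,\mathbf y)$ in which the parameters $\mathbf y$ are replaced by elements of the lattice. -}

module Defs where

open import Level using (Level; _⊔_) renaming (suc to lsuc)
open import Data.Nat using (ℕ; suc; _+_)
open import Data.Fin using (Fin)
open import Data.Vec using (Vec; _∷_; _++_; lookup)
open import Data.Product using (Σ; _×_; ∃)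
open import Data.Sum using (_⊎_)
open import Relation.Nullary using (¬_)
open import Algebra.Lattice.Bundles using (Lattice)
open import Algebra.Lattice.Morphism.Structures using (module LatticeMorphisms)

data Term (n : ℕ) : Set where
  var  : Fin n → Term n
  _∨ₜ_ : Term n → Term n → Term n
  _∧ₜ_ : Term n → Term n → Term n

data PosFormula (n : ℕ) : Set where
  _≐_  : Term n → Term n → PosFormula n
  _and_ : PosFormula n → PosFormula n → PosFormula n
  _or_  : PosFormula n → PosFormula n → PosFormula n

-- A positive ∀∃-sentence  ∀ x₁…xₘ ∃ y₁…yₖ φ(x, y)  with φ positive quantifier-free.
record ∀∃Sentence : Set where
  constructor ∀∃
  field
    m k  : ℕ
    body : PosFormula (m + k)

module _ {c ℓ} (L : Lattice c ℓ) where
  open Lattice L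

  ⟦_⟧ₜ : ∀ {n} → Term n → Vec Carrier n → Carrier
  ⟦ var i ⟧ₜ ρ = lookup ρ i
  ⟦ s ∨ₜ t ⟧ₜ ρ = ⟦ s ⟧ₜ ρ ∨ ⟦ t ⟧ₜ ρ
  ⟦ s ∧ₜ t ⟧ₜ ρ = ⟦ s ⟧ₜ ρ ∧ ⟦ t ⟧ₜ ρ

  ⟦_⟧f : ∀ {n} → PosFormula n → Vec Carrier n → Set ℓ
  ⟦ s ≐ t ⟧f ρ = ⟦ s ⟧ₜ ρ ≈ ⟦ t ⟧ₜ ρ
  ⟦ φ and ψ ⟧f ρ = ⟦ φ ⟧f ρ × ⟦ ψ ⟧f ρ
  ⟦ φ or ψ ⟧f ρ = ⟦ φ ⟧f ρ ⊎ ⟦ ψ ⟧f ρ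

  _⊨_ : ∀∃Sentence → Set (c ⊔ ℓ)
  _⊨_ (∀∃ m k φ) = (xs : Vec Carrier m) → Σ (Vec Carrier k) λ ys → ⟦ φ ⟧f (xs ++ ys)

  FixedPointFree : ∀ {n} → Term (suc n) → Vec Carrier n → Set (c ⊔ ℓ)
  FixedPointFree p b = ∀ (a : Carrier) → ¬ (⟦ p ⟧ₜ (a ∷ b) ≈ a)

  _≤L_ : Carrier → Carrier → Set ℓ
  x ≤L y = (x ∧ y) ≈ x

  IsSupremum : ∀ {p} → (Carrier → Set p) → Carrier → Set (c ⊔ ℓ ⊔ p)
  IsSupremum P s = (∀ x → P x → x ≤L s) × (∀ u → (∀ x → P x → x ≤L u) → s ≤L u)

record CompleteLattice c ℓ : Set (lsuc (c ⊔ ℓ)) where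
  field
    lattice : Lattice c ℓ
  open Lattice lattice public
  field
    ⋁ : (Carrier → Set (c ⊔ ℓ)) → Carrier
    ⋁-isSup : ∀ P → IsSupremum lattice P (⋁ P)

-- L₀ is (isomorphic to) a sublattice of L₁ via the injective lattice homomorphism f.
IsSublatticeEmbedding : ∀ {c₀ ℓ₀ c₁ ℓ₁} (L₀ : Lattice c₀ ℓ₀) (L₁ : Lattice c₁ ℓ₁) →
  (Lattice.Carrier L₀ → Lattice.Carrier L₁) → Set (c₀ ⊔ ℓ₀ ⊔ ℓ₁)
IsSublatticeEmbedding L₀ L₁ f =
  LatticeMorphisms.IsLatticeMonomorphism (Lattice.rawLattice L₀) (Lattice.rawLattice L₁) f

{-# OPTIONS --safe #-}
module Submission where

-- By Knaster–Tarski every monotone self-map of a complete lattice has a fixed point, and lattice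
-- polynomials are monotone. Hence the positive ∀∃-sentence  ∀ y ∃ x. p(x, y) ≈ x  holds in L₁
-- (indeed in every complete lattice), while instantiating y := b refutes it in L₀.

open import Defs
open import Level using (Lift; lift; lower; _⊔_)
open import Data.Nat using (ℕ; suc; _+_)
open import Data.Fin using (Fin; zero; suc; _↑ˡ_; _↑ʳ_)
open import Data.Vec using (Vec; _∷_; []; _++_; lookup)
open import Data.Vec.Properties using (lookup-++ˡ; lookup-++ʳ)
open import Data.Product using (Σ; _×_; _,_; proj₁; proj₂)
open import Function using (_⇔_; mk⇔; Equivalence)
open import Relation.Nullary using (¬_)
open import Relation.Binary.Definitions using (Monotonic₁)
open import Relation.Binary.PropositionalEquality as ≡ using (_≡_; cong₂; subst)
open import Algebra.Lattice.Bundles using (Lattice)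
import Algebra.Lattice.Properties.Lattice as LatticeProperties
import Relation.Binary.Lattice.Bundles as OrderTheoretic
import Relation.Binary.Lattice.Properties.JoinSemilattice as JoinSemilatticeProperties
import Relation.Binary.Lattice.Properties.MeetSemilattice as MeetSemilatticeProperties

rename : ∀ {m n} → (Fin m → Fin n) → Term m → Term n
rename r (var i) = var (r i)
rename r (s ∨ₜ t) = rename r s ∨ₜ rename r t
rename r (s ∧ₜ t) = rename r s ∧ₜ rename r t

headToLast : ∀ {n} → Fin (suc n) → Fin (n + 1)
headToLast {n} zero = n ↑ʳ zero
headToLast (suc i) = i ↑ˡ 1

lookup-++-headToLast : ∀ {a} {A : Set a} {n} (xs : Vec A n) (x : A) (i : Fin (suc n)) →
  lookup (xs ++ x ∷ []) (headToLast i) ≡ lookup (x ∷ xs) i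
lookup-++-headToLast xs x zero = lookup-++ʳ xs (x ∷ []) zero
lookup-++-headToLast xs x (suc i) = lookup-++ˡ xs (x ∷ []) i

-- The sentence  ∀ y₁…yₙ ∃ x. p(x, y) ≈ x ; the existential variable x comes last in ∀∃Sentence.
fixedPointSentence : ∀ {n} → Term (suc n) → ∀∃Sentence
fixedPointSentence {n} p = ∀∃ n 1 (rename headToLast p ≐ var (headToLast zero))

module _ {c ℓ} (L : Lattice c ℓ) where
  open Lattice L
  open OrderTheoretic.Lattice (LatticeProperties.∨-∧-orderTheoreticLattice L)
    using (_≤_; joinSemilattice; meetSemilattice) renaming (refl to ≤-refl)
  open JoinSemilatticeProperties joinSemilattice using (∨-monotonic)
  open MeetSemilatticeProperties meetSemilattice using (∧-monotonic)

  ⟦rename⟧ₜ : ∀ {m n} (r : Fin m → Fin n) (t : Term m) {ρ : Vec Carrier n} {σ : Vec Carrier m} →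
    (∀ i → lookup ρ (r i) ≡ lookup σ i) → ⟦ L ⟧ₜ (rename r t) ρ ≡ ⟦ L ⟧ₜ t σ
  ⟦rename⟧ₜ r (var i) ρ∘r≗σ = ρ∘r≗σ i
  ⟦rename⟧ₜ r (s ∨ₜ t) ρ∘r≗σ = cong₂ _∨_ (⟦rename⟧ₜ r s ρ∘r≗σ) (⟦rename⟧ₜ r t ρ∘r≗σ)
  ⟦rename⟧ₜ r (s ∧ₜ t) ρ∘r≗σ = cong₂ _∧_ (⟦rename⟧ₜ r s ρ∘r≗σ) (⟦rename⟧ₜ r t ρ∘r≗σ)

  ⟦⟧ₜ-monotonicˡ : ∀ {n} (t : Term (suc n)) (ρ : Vec Carrier n) →
    Monotonic₁ _≤_ _≤_ (λ x → ⟦ L ⟧ₜ t (x ∷ ρ))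
  ⟦⟧ₜ-monotonicˡ (var zero) ρ x≤y = x≤y
  ⟦⟧ₜ-monotonicˡ (var (suc i)) ρ x≤y = ≤-refl
  ⟦⟧ₜ-monotonicˡ (s ∨ₜ t) ρ x≤y = ∨-monotonic (⟦⟧ₜ-monotonicˡ s ρ x≤y) (⟦⟧ₜ-monotonicˡ t ρ x≤y)
  ⟦⟧ₜ-monotonicˡ (s ∧ₜ t) ρ x≤y = ∧-monotonic (⟦⟧ₜ-monotonicˡ s ρ x≤y) (⟦⟧ₜ-monotonicˡ t ρ x≤y)

  ⟦fixedPointSentence⟧f : ∀ {n} (p : Term (suc n)) (ρ : Vec Carrier n) (x : Carrier) →
    ⟦ L ⟧f (∀∃Sentence.body (fixedPointSentence p)) (ρ ++ x ∷ []) ≡ (⟦ L ⟧ₜ p (x ∷ ρ) ≈ x)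
  ⟦fixedPointSentence⟧f p ρ x =
    cong₂ _≈_ (⟦rename⟧ₜ headToLast p (lookup-++-headToLast ρ x)) (lookup-++-headToLast ρ x zero)

  ⊨fixedPointSentence⇔ : ∀ {n} (p : Term (suc n)) →
    _⊨_ L (fixedPointSentence p) ⇔ (∀ ρ → Σ Carrier λ x → ⟦ L ⟧ₜ p (x ∷ ρ) ≈ x)
  ⊨fixedPointSentence⇔ p = mk⇔ to from
    where
    to : _⊨_ L (fixedPointSentence p) → ∀ ρ → Σ Carrier λ x → ⟦ L ⟧ₜ p (x ∷ ρ) ≈ x
    to ⊨σ ρ with ⊨σ ρ
    ... | x ∷ [] , holds = x , subst (λ A → A) (⟦fixedPointSentence⟧f p ρ x) holds

    from : (∀ ρ → Σ Carrier λ x → ⟦ L ⟧ₜ p (x ∷ ρ) ≈ x) → _⊨_ L (fixedPointSentence p)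
    from fixed ρ with fixed ρ
    ... | x , px≈x = x ∷ [] , subst (λ A → A) (≡.sym (⟦fixedPointSentence⟧f p ρ x)) px≈x

module _ {c ℓ} (L : CompleteLattice c ℓ) where
  open CompleteLattice L
  open OrderTheoretic.Lattice (LatticeProperties.∨-∧-orderTheoreticLattice lattice)
    using (_≤_; antisym) renaming (trans to ≤-trans)

  knaster-tarski : {g : Carrier → Carrier} → Monotonic₁ _≤_ _≤_ g → Σ Carrier λ s → g s ≈ s
  knaster-tarski {g} g-mono = s , antisym gs≤s s≤gs
    where
    PostFixed : Carrier → Set (c ⊔ ℓ)
    PostFixed x = Lift c (x ≤ g x)

    s : Carrier
    s = ⋁ PostFixed

    -- Defs orders by  x ∧ y ≈ x , the order-theoretic lattice by  x ≈ x ∧ y .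
    upper : ∀ x → PostFixed x → x ≤ s
    upper x x≤gx = sym (proj₁ (⋁-isSup PostFixed) x x≤gx)

    s≤gs : s ≤ g s
    s≤gs = sym (proj₂ (⋁-isSup PostFixed) (g s) λ x x≤gx →
      sym (≤-trans (lower x≤gx) (g-mono (upper x x≤gx))))

    gs≤s : g s ≤ s
    gs≤s = upper (g s) (lift (g-mono s≤gs))

  polynomial-hasFixedPoint : ∀ {n} (p : Term (suc n)) (ρ : Vec Carrier n) →
    Σ Carrier λ x → ⟦ lattice ⟧ₜ p (x ∷ ρ) ≈ x
  polynomial-hasFixedPoint p ρ = knaster-tarski (⟦⟧ₜ-monotonicˡ lattice p ρ)

lemma4p18 : ∀ {c₀ ℓ₀ c₁ ℓ₁} (L₀ : Lattice c₀ ℓ₀) (L₁ : CompleteLattice c₁ ℓ₁)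
    (n : ℕ) (p : Term (suc n)) (b : Vec (Lattice.Carrier L₀) n) →
    FixedPointFree L₀ p b →
    (f : Lattice.Carrier L₀ → CompleteLattice.Carrier L₁) →
    IsSublatticeEmbedding L₀ (CompleteLattice.lattice L₁) f →
    Σ ∀∃Sentence λ σ → (_⊨_ (CompleteLattice.lattice L₁) σ) × (¬ (_⊨_ L₀ σ))
lemma4p18 L₀ L₁ n p b fixedPointFree _ _ = fixedPointSentence p , holdsIn₁ , failsIn₀
  where
  holdsIn₁ : _⊨_ (CompleteLattice.lattice L₁) (fixedPointSentence p)
  holdsIn₁ = Equivalence.from (⊨fixedPointSentence⇔ (CompleteLattice.lattice L₁) p)
    (polynomial-hasFixedPoint L₁ p)

  failsIn₀ : ¬ (_⊨_ L₀ (fixedPointSentence p))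
  failsIn₀ ⊨σ with Equivalence.to (⊨fixedPointSentence⇔ L₀ p) ⊨σ b
  ... | a , pa≈a = fixedPointFree a pa≈a
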